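{- Let $s\geq 2$ be an integer. Assume that the edge set of a complete graph $K_{s+2}$ is partitioned into cliques $C_1,\dots,C_k$, each having at most $s$ vertices. Then there exist four vertices of $K_{s+2}$ such that the six edges between them all belong to pairwise different cliques $C_i$.
   Context: Here a partition of the edge set into cliques means that each $C_i$ is a set of vertices, and every edge of $K_{s+2}$ has both endpoints in exactly one $C_i$. -}

module Defs where

open import Data.Nat using (ℕ; _≤_)
open import Data.Fin using (Fin)
open import Data.Fin.Subset using (Subset; _∈_; ∣_∣)
open import Data.Product using (Σ; ∃; ∃-syntax; _×_; _,_)
open import Relation.Binary.PropositionalEquality using (_≡_; _≢_)

EdgeIn : {n : ℕ} → Fin n → Fin n → Subset n → Set
EdgeIn u v C = u ∈ C × v ∈ C

IsCliquePartition : {n k : ℕ} → (Fin k → Subset n) → Set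
IsCliquePartition {n} {k} C =
  (u v : Fin n) → u ≢ v →
    (∃[ i ] EdgeIn u v (C i)) ×
    ((i j : Fin k) → EdgeIn u v (C i) → EdgeIn u v (C j) → i ≡ j)

PairwiseDistinct6 : {A : Set} → A → A → A → A → A → A → Set
PairwiseDistinct6 x₁ x₂ x₃ x₄ x₅ x₆ =
  x₁ ≢ x₂ × x₁ ≢ x₃ × x₁ ≢ x₄ × x₁ ≢ x₅ × x₁ ≢ x₆ ×
  x₂ ≢ x₃ × x₂ ≢ x₄ × x₂ ≢ x₅ × x₂ ≢ x₆ ×
  x₃ ≢ x₄ × x₃ ≢ x₅ × x₃ ≢ x₆ ×
  x₄ ≢ x₅ × x₄ ≢ x₆ ×
  x₅ ≢ x₆

RainbowK4 : {n k : ℕ} → (Fin k → Subset n) → Set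
RainbowK4 {n} {k} C =
  Σ (Fin n) λ a → Σ (Fin n) λ b → Σ (Fin n) λ c → Σ (Fin n) λ d →
  (a ≢ b × a ≢ c × a ≢ d × b ≢ c × b ≢ d × c ≢ d) ×
  Σ (Fin k) λ iab → Σ (Fin k) λ iac → Σ (Fin k) λ iad →
  Σ (Fin k) λ ibc → Σ (Fin k) λ ibd → Σ (Fin k) λ icd →
  (EdgeIn a b (C iab) × EdgeIn a c (C iac) × EdgeIn a d (C iad) ×
   EdgeIn b c (C ibc) × EdgeIn b d (C ibd) × EdgeIn c d (C icd)) ×
  PairwiseDistinct6 iab iac iad ibc ibd icd

-- If no clique contains three vertices, any four vertices span a rainbow K₄:
-- two of their edges in one clique would put three of the four vertices in it.
-- Otherwise some clique Cᵢ contains a triangle u v w. As ∣Cᵢ∣ ≤ n − 2, two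
-- vertices x y lie outside Cᵢ; let D be the clique of xy. Two cliques share at
-- most one vertex, so two of u v w, say a b, lie outside D. Among a b x y no
-- three vertices lie in a common clique (a triple through ab would meet Cᵢ, a
-- triple through xy would meet D), so a b x y span a rainbow K₄.
module Submission where

open import Defs
open import Data.Nat using (ℕ; _≤_; _<_; _+_; s≤s)
open import Data.Nat.Properties using (+-comm; +-monoˡ-≤)
open import Data.Fin using (Fin; _≟_) renaming (zero to fzero; suc to fsuc)
open import Data.Fin.Properties using (any?; suc-injective)
open import Data.Fin.Subset using (Subset; ∣_∣; _∈_; _∉_; inside; outside)
open import Data.Fin.Subset.Properties using (_∈?_; drop-there)
open import Data.Vec using (_∷_)
open import Data.Product using (Σ; ∃; ∃-syntax; _×_; _,_; proj₁; proj₂)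
open import Data.Empty using (⊥)
open import Relation.Nullary using (¬_; Dec; yes; no)
open import Relation.Nullary.Decidable using (¬?; _×-dec_)
open import Relation.Binary.PropositionalEquality using (_≡_; _≢_; refl; sym; subst)

Distinct4 : {A : Set} → A → A → A → A → Set
Distinct4 a b c d = a ≢ b × a ≢ c × a ≢ d × b ≢ c × b ≢ d × c ≢ d

∣p∣<n⇒∃∉ : {n : ℕ} (p : Subset n) → ∣ p ∣ < n → ∃[ x ] x ∉ p
∣p∣<n⇒∃∉ (outside ∷ p) _       = fzero , λ ()
∣p∣<n⇒∃∉ (inside  ∷ p) (s≤s h) with ∣p∣<n⇒∃∉ p h
... | x , x∉p = fsuc x , λ x∈ → x∉p (drop-there x∈)

2+∣p∣≤n⇒∃₂∉ : {n : ℕ} (p : Subset n) → 2 + ∣ p ∣ ≤ n →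
  ∃[ x ] ∃[ y ] x ≢ y × x ∉ p × y ∉ p
2+∣p∣≤n⇒∃₂∉ (outside ∷ p) (s≤s h) with ∣p∣<n⇒∃∉ p h
... | y , y∉p = fzero , fsuc y , (λ ()) , (λ ()) , λ y∈ → y∉p (drop-there y∈)
2+∣p∣≤n⇒∃₂∉ (inside ∷ p) (s≤s h) with 2+∣p∣≤n⇒∃₂∉ p h
... | x , y , x≢y , x∉p , y∉p =
  fsuc x , fsuc y , (λ e → x≢y (suc-injective e)) ,
  (λ x∈ → x∉p (drop-there x∈)) , (λ y∈ → y∉p (drop-there y∈))

4≤n⇒∃-Distinct4 : {n : ℕ} → 4 ≤ n → Σ (Fin n) λ a → Σ (Fin n) λ b →
  Σ (Fin n) λ c → Σ (Fin n) λ d → Distinct4 a b c d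
4≤n⇒∃-Distinct4 (s≤s (s≤s (s≤s (s≤s _)))) =
  fzero , fsuc fzero , fsuc (fsuc fzero) , fsuc (fsuc (fsuc fzero)) ,
  (λ ()) , (λ ()) , (λ ()) , (λ ()) , (λ ()) , (λ ())

module CliquePartition {n k : ℕ} (C : Fin k → Subset n) (part : IsCliquePartition C) where

  NotCocliqual : Fin n → Fin n → Fin n → Set
  NotCocliqual u v w = ∀ i → u ∈ C i → v ∈ C i → w ∈ C i → ⊥

  NotCocliqual-swap : ∀ {u v w} → NotCocliqual u v w → NotCocliqual u w v
  NotCocliqual-swap t i u∈ w∈ v∈ = t i u∈ v∈ w∈

  Triangle : Set
  Triangle = ∃[ i ] ∃[ u ] ∃[ v ] ∃[ w ]
    (u ≢ v × u ≢ w × v ≢ w) × (u ∈ C i × v ∈ C i × w ∈ C i)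

  triangle? : Dec Triangle
  triangle? = any? λ i → any? λ u → any? λ v → any? λ w →
    (¬? (u ≟ v) ×-dec ¬? (u ≟ w) ×-dec ¬? (v ≟ w)) ×-dec
    (u ∈? C i ×-dec v ∈? C i ×-dec w ∈? C i)

  clique-unique : ∀ {u v i j} → u ≢ v →
    u ∈ C i → v ∈ C i → u ∈ C j → v ∈ C j → i ≡ j
  clique-unique {u} {v} {i} {j} u≢v ui vi uj vj =
    proj₂ (part u v u≢v) i j (ui , vi) (uj , vj)

  ∉-clique-of-edge : ∀ {u v w i j} → u ≢ v → u ∈ C i → v ∈ C i → w ∉ C i →
    u ∈ C j → v ∈ C j → w ∉ C j
  ∉-clique-of-edge u≢v ui vi w∉i uj vj w∈j =
    w∉i (subst (λ t → _ ∈ C t) (sym (clique-unique u≢v ui vi uj vj)) w∈j)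

  cliques-differ : ∀ {i j x y z} → NotCocliqual x y z →
    x ∈ C i → y ∈ C i → z ∈ C j → i ≢ j
  cliques-differ t x∈ y∈ z∈ refl = t _ x∈ y∈ z∈

  rainbow : ∀ a b c d → Distinct4 a b c d →
    NotCocliqual a b c → NotCocliqual a b d →
    NotCocliqual a c d → NotCocliqual b c d → RainbowK4 C
  rainbow a b c d ds@(ab , ac , ad , bc , bd , cd) tabc tabd tacd tbcd
    with proj₁ (part a b ab) | proj₁ (part a c ac) | proj₁ (part a d ad)
       | proj₁ (part b c bc) | proj₁ (part b d bd) | proj₁ (part c d cd)
  ... | iab , (a₁ , b₁) | iac , (a₂ , c₂) | iad , (a₃ , d₃)
      | ibc , (b₄ , c₄) | ibd , (b₅ , d₅) | icd , (c₆ , d₆) =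
    a , b , c , d , ds , iab , iac , iad , ibc , ibd , icd ,
    ((a₁ , b₁) , (a₂ , c₂) , (a₃ , d₃) , (b₄ , c₄) , (b₅ , d₅) , (c₆ , d₆)) ,
    cliques-differ tabc a₁ b₁ c₂ , cliques-differ tabd a₁ b₁ d₃ ,
    cliques-differ tabc a₁ b₁ c₄ , cliques-differ tabd a₁ b₁ d₅ ,
    cliques-differ tabc a₁ b₁ c₆ ,
    cliques-differ tacd a₂ c₂ d₃ , cliques-differ (NotCocliqual-swap tabc) a₂ c₂ b₄ ,
    cliques-differ (NotCocliqual-swap tabc) a₂ c₂ b₅ , cliques-differ tacd a₂ c₂ d₆ ,
    cliques-differ (NotCocliqual-swap tabd) a₃ d₃ b₄ ,
    cliques-differ (NotCocliqual-swap tabd) a₃ d₃ b₅ ,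
    cliques-differ (NotCocliqual-swap tacd) a₃ d₃ c₆ ,
    cliques-differ tbcd b₄ c₄ d₅ , cliques-differ tbcd b₄ c₄ d₆ ,
    cliques-differ (NotCocliqual-swap tbcd) b₅ d₅ c₆

  ¬Triangle⇒rainbow : 4 ≤ n → ¬ Triangle → RainbowK4 C
  ¬Triangle⇒rainbow 4≤n ¬tri with 4≤n⇒∃-Distinct4 4≤n
  ... | a , b , c , d , ds@(ab , ac , ad , bc , bd , cd) =
    rainbow a b c d ds
      (λ i p q r → ¬tri (i , a , b , c , (ab , ac , bc) , (p , q , r)))
      (λ i p q r → ¬tri (i , a , b , d , (ab , ad , bd) , (p , q , r)))
      (λ i p q r → ¬tri (i , a , c , d , (ac , ad , cd) , (p , q , r)))
      (λ i p q r → ¬tri (i , b , c , d , (bc , bd , cd) , (p , q , r)))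

  rainbow-from-two-edges : ∀ {i j a b x y} → a ≢ b → x ≢ y →
    a ∈ C i → b ∈ C i → x ∉ C i → y ∉ C i →
    x ∈ C j → y ∈ C j → a ∉ C j → b ∉ C j → RainbowK4 C
  rainbow-from-two-edges {a = a} {b} {x} {y} a≢b x≢y ai bi x∉i y∉i xj yj a∉j b∉j =
    rainbow a b x y
      (a≢b , ≢-by-membership ai x∉i , ≢-by-membership ai y∉i ,
       ≢-by-membership bi x∉i , ≢-by-membership bi y∉i , x≢y)
      (λ _ p q r → ∉-clique-of-edge a≢b ai bi x∉i p q r)
      (λ _ p q r → ∉-clique-of-edge a≢b ai bi y∉i p q r)
      (λ _ p q r → ∉-clique-of-edge x≢y xj yj a∉j q r p)
      (λ _ p q r → ∉-clique-of-edge x≢y xj yj b∉j q r p)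
    where
    ≢-by-membership : ∀ {u v l} → u ∈ C l → v ∉ C l → u ≢ v
    ≢-by-membership u∈ v∉ refl = v∉ u∈

  edge-of-triangle-avoiding : ∀ {i j u v w x} → u ≢ v → u ≢ w → v ≢ w →
    u ∈ C i → v ∈ C i → w ∈ C i → x ∉ C i → x ∈ C j →
    ∃[ a ] ∃[ b ] a ≢ b × a ∈ C i × b ∈ C i × a ∉ C j × b ∉ C j
  edge-of-triangle-avoiding {j = j} {u} {v} {w} uv uw vw ui vi wi x∉i xj
    with u ∈? C j | v ∈? C j
  ... | yes uj | _      = v , w , vw , vi , wi ,
                          (λ vj → ∉-clique-of-edge uv ui vi x∉i uj vj xj) ,
                          (λ wj → ∉-clique-of-edge uw ui wi x∉i uj wj xj)
  ... | no u∉j | yes vj = u , w , uw , ui , wi , u∉j ,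
                          λ wj → ∉-clique-of-edge vw vi wi x∉i vj wj xj
  ... | no u∉j | no v∉j = u , v , uv , ui , vi , u∉j , v∉j

  Triangle⇒rainbow : (∀ i → ∣ C i ∣ + 2 ≤ n) → Triangle → RainbowK4 C
  Triangle⇒rainbow small (i , u , v , w , (uv , uw , vw) , (ui , vi , wi))
    with 2+∣p∣≤n⇒∃₂∉ (C i) (subst (_≤ n) (+-comm ∣ C i ∣ 2) (small i))
  ... | x , y , xy , x∉i , y∉i with proj₁ (part x y xy)
  ...   | j , (xj , yj) with edge-of-triangle-avoiding uv uw vw ui vi wi x∉i xj
  ...     | a , b , ab , ai , bi , a∉j , b∉j =
    rainbow-from-two-edges ab xy ai bi x∉i y∉i xj yj a∉j b∉j

lemma2p2 : (s : ℕ) → 2 ≤ s → (k : ℕ) → (C : Fin k → Subset (s + 2)) →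
    IsCliquePartition C → ((i : Fin k) → ∣ C i ∣ ≤ s) → RainbowK4 C
lemma2p2 s 2≤s k C part small with CliquePartition.triangle? C part
... | yes tri = CliquePartition.Triangle⇒rainbow C part (λ i → +-monoˡ-≤ 2 (small i)) tri
... | no ¬tri = CliquePartition.¬Triangle⇒rainbow C part (+-monoˡ-≤ 2 2≤s) ¬tri
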